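{- Let $G$ be a semi-balanced digraph without multiple edges, with a ribbon structure and a basis $(b_0,b_0b_1)$. Then the greedy tree procedure described below outputs a subgraph $H$ that is a tree (not necessarily spanning).
   Context: A digraph is semi-balanced if on every cycle the numbers of edges pointing in the two cyclic directions are equal. Ribbon structure: for each vertex $x$ a cyclic order of the edges incident to $x$ (in- and out-edges); $xy^+$ is the edge following $xy$ at $x$. Basis: a vertex $b_0$ and an edge $b_0b_1$ of $G$ incident to it. Greedy tree procedure: start with $H=\emptyset$ and current node-edge pair $(b_0,b_0b_1)$. If the current pair is $(h,ht)$ where $h$ is the head of the edge: if $(t,th)$ has not yet been current, include the edge into $H$ and let $(t,th^+)$ be the next current pair; otherwise do not include it and let $(h,ht^+)$ be next. If the current pair is $(t,th)$ where $t$ is the tail: if $(h,ht)$ has not yet been current, do not include the edge and let $(t,th^+)$ be next; if $(h,ht)$ has already been current, let $(h,ht^+)$ be next. The process stops when some node-edge pair becomes current for the second time; the output is $H$. -}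

module Defs where

open import Data.Nat using (ℕ; zero; suc; _+_; _<_)
open import Data.Fin using (Fin) renaming (_≟_ to _≟F_)
open import Data.Bool using (Bool; true; false; if_then_else_)
open import Data.List using (List; []; _∷_)
open import Data.Bool.ListAction using (any)
open import Data.Empty using (⊥)
open import Data.Unit using (⊤)
open import Data.List.Membership.Propositional using (_∈_)
open import Data.List.Relation.Unary.All using (All)
open import Data.List.Relation.Unary.Unique.Propositional using (Unique)
open import Data.Product using (Σ; ∃; _×_; _,_; proj₁; proj₂)
open import Data.Product.Properties using (≡-dec)
open import Data.Sum using (_⊎_)
open import Function using (_∘_)
open import Relation.Nullary using (¬_; Dec; yes; no)
open import Relation.Nullary.Decidable using (⌊_⌋)
open import Relation.Binary.PropositionalEquality using (_≡_)

record Digraph (n m : ℕ) : Set where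
  field
    tail : Fin m → Fin n
    head : Fin m → Fin n

module _ {n m : ℕ} (G : Digraph n m) where
  open Digraph G

  NoMultipleEdges : Set
  NoMultipleEdges = ∀ e e' → tail e ≡ tail e' → head e ≡ head e' → e ≡ e'

  Incident : Fin n → Fin m → Set
  Incident x e = tail e ≡ x ⊎ head e ≡ x

  data Walk : Fin n → Fin n → Set where
    []  : ∀ {u} → Walk u u
    fwd : ∀ {u w} (e : Fin m) → tail e ≡ u → Walk (head e) w → Walk u w
    bwd : ∀ {u w} (e : Fin m) → head e ≡ u → Walk (tail e) w → Walk u w

  edges : ∀ {u w} → Walk u w → List (Fin m)
  edges []          = []
  edges (fwd e _ p) = e ∷ edges p
  edges (bwd e _ p) = e ∷ edges p

  starts : ∀ {u w} → Walk u w → List (Fin n)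
  starts []              = []
  starts (fwd {u} e _ p) = u ∷ starts p
  starts (bwd {u} e _ p) = u ∷ starts p

  #fwd : ∀ {u w} → Walk u w → ℕ
  #fwd []          = 0
  #fwd (fwd e _ p) = suc (#fwd p)
  #fwd (bwd e _ p) = #fwd p

  #bwd : ∀ {u w} → Walk u w → ℕ
  #bwd []          = 0
  #bwd (fwd e _ p) = #bwd p
  #bwd (bwd e _ p) = suc (#bwd p)

  NonEmpty : ∀ {u w} → Walk u w → Set
  NonEmpty []          = ⊥
  NonEmpty (fwd _ _ _) = ⊤
  NonEmpty (bwd _ _ _) = ⊤

  IsCycle : ∀ {u} → Walk u u → Set
  IsCycle w = NonEmpty w × Unique (edges w) × Unique (starts w)

  SemiBalanced : Set
  SemiBalanced = ∀ u (w : Walk u u) → IsCycle w → #fwd w ≡ #bwd w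

  -- a ribbon structure: for each vertex x a cyclic order of the edges
  -- incident to x, given by its successor map  e ↦ e⁺  (the values of
  -- next x on edges not incident to x are irrelevant)
  iter : ℕ → (Fin m → Fin m) → Fin m → Fin m
  iter zero    f e = e
  iter (suc k) f e = f (iter k f e)

  record Ribbon : Set where
    field
      next        : Fin n → Fin m → Fin m
      next-inc    : ∀ x e → Incident x e → Incident x (next x e)
      next-cyclic : ∀ x e e' → Incident x e → Incident x e' →
                    ∃ λ k → iter k (next x) e ≡ e'

  Touches : List (Fin m) → Fin n → Set
  Touches H x = ∃ λ e → e ∈ H × Incident x e

  IsTree : List (Fin m) → Set
  IsTree H =
    (∀ u (w : Walk u u) → IsCycle w → ¬ All (_∈ H) (edges w)) ×
    (∀ x y → Touches H x → Touches H y →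
       ∃ λ (w : Walk x y) → All (_∈ H) (edges w))

  Pair : Set
  Pair = Fin n × Fin m

  _∈?_ : Pair → List Pair → Bool
  p ∈? ps = any (λ q → ⌊ ≡-dec _≟F_ _≟F_ p q ⌋) ps

  record State : Set where
    constructor st
    field
      cur  : Pair
      past : List Pair
      H    : List (Fin m)

  module Greedy (R : Ribbon) where
    open Ribbon R

    step : State → State
    step (st (x , e) past H) with head e ≟F x
    ... | yes _ =
      let t = tail e in
      if (t , e) ∈? past
        then st (x , next x e) ((x , e) ∷ past) H
        else st (t , next t e) ((x , e) ∷ past) (e ∷ H)
    ... | no _ =
      let h = head e in
      if (h , e) ∈? past
        then st (h , next h e) ((x , e) ∷ past) H
        else st (x , next x e) ((x , e) ∷ past) H

    init : Fin n → Fin m → State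
    init b₀ b₀b₁ = st (b₀ , b₀b₁) [] []

    run : ℕ → State → State
    run zero    s = s
    run (suc k) s = run k (step s)

    Stopped : State → Set
    Stopped s = State.cur s ∈ State.past s

    Outputs : Fin n → Fin m → List (Fin m) → Set
    Outputs b₀ b₀b₁ H =
      ∃ λ k → Stopped (run k (init b₀ b₀b₁)) ×
              (∀ j → j < k → ¬ Stopped (run j (init b₀ b₀b₁))) ×
              State.H (run k (init b₀ b₀b₁)) ≡ H

-- The greedy procedure is a depth-first search from b₀: an edge is included
-- when first met at its head, the search then continues at its tail, and it
-- backtracks along the edge when it meets it at the tail again.  Throughout,
-- the included edges form a tree oriented towards b₀, and the current vertex
-- is joined to b₀ by a directed path of tree edges (the stack).  Because the
-- ribbon order at a vertex is cyclic, a vertex that was left and is not on the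
-- stack has been completely explored; and the tail of an edge met at its head
-- cannot lie on the stack, as it would close a directed cycle, which
-- semi-balance forbids.  So each included edge hangs a new leaf on the tree.
-- The procedure stops by the pigeonhole principle on node-edge pairs.
{-# OPTIONS --safe #-}
module Submission where

open import Defs
open import Data.Nat using (ℕ; zero; suc; _+_; _*_; _<_; z<s; s<s)
open import Data.Nat.Properties using (+-identityʳ; +-suc; m<1+n⇒m<n∨m≡n; n<1+n)
open import Data.Fin using (Fin; combine; toℕ) renaming (_≟_ to _≟F_)
open import Data.Fin.Properties using (pigeonhole; combine-injective)
open import Data.Bool using (Bool; true; false; not; T)
open import Data.Bool.Properties using (not-¬)
open import Data.List using (List; []; _∷_; map)
open import Data.List.Membership.Propositional using (_∈_; _∉_)
open import Data.List.Relation.Binary.Subset.Propositional using (_⊆_)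
open import Data.List.Relation.Unary.Any as Any using (here; there)
open import Data.List.Relation.Unary.Any.Properties using (any⁺; any⁻)
open import Data.List.Relation.Unary.All as All using (All; []; _∷_)
open import Data.List.Relation.Unary.All.Properties.Core using (¬Any⇒All¬; All¬⇒¬Any)
open import Data.List.Relation.Unary.AllPairs.Core using ([]; _∷_)
open import Data.List.Relation.Unary.Unique.Propositional using (Unique)
open import Data.List.Relation.Unary.Unique.Propositional.Properties using (map⁻)
open import Data.Product as Product using (Σ; ∃; _×_; _,_; proj₁; proj₂)
open import Data.Product.Properties using (≡-dec; ×-≡,≡←≡; ×-≡,≡→≡)
open import Data.Sum as Sum using (_⊎_; inj₁; inj₂)
open import Data.Empty using (⊥)
open import Data.Unit using (⊤; tt)
open import Function using (_∘_; id)
open import Relation.Nullary using (¬_; Dec; yes; no; contradiction)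
open import Relation.Nullary.Decidable using (does; dec-true; dec-false; toWitness; fromWitness)
open import Relation.Unary using (Decidable)
open import Relation.Binary.PropositionalEquality
  using (_≡_; _≢_; refl; sym; trans; cong; subst)

Least : (ℕ → Set) → Set
Least P = ∃ λ k → P k × (∀ j → j < k → ¬ P j)

module _ {P : ℕ → Set} (P? : Decidable P) where

  least-from : ∀ i d → (∀ j → j < i → ¬ P j) → P (d + i) → Least P
  least-from i d below p with P? i
  ... | yes pᵢ = i , pᵢ , below
  least-from i zero    below p | no ¬pᵢ = contradiction p ¬pᵢ
  least-from i (suc d) below p | no ¬pᵢ =
    least-from (suc i) d below′ (subst P (sym (+-suc d i)) p)
    where
      below′ : ∀ j → j < suc i → ¬ P j
      below′ j j<1+i with m<1+n⇒m<n∨m≡n j<1+i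
      ... | inj₁ j<i  = below j j<i
      ... | inj₂ refl = ¬pᵢ

  least : ∀ {k} → P k → Least P
  least {k} p = least-from 0 k (λ _ ()) (subst P (sym (+-identityʳ k)) p)

module Walks {n m} (G : Digraph n m) where
  open Digraph G

  _++ʷ_ : ∀ {u v w} → Walk G u v → Walk G v w → Walk G u w
  []         ++ʷ q = q
  fwd e eq p ++ʷ q = fwd e eq (p ++ʷ q)
  bwd e eq p ++ʷ q = bwd e eq (p ++ʷ q)

  reverseʷ : ∀ {u v} → Walk G u v → Walk G v u
  reverseʷ []             = []
  reverseʷ (fwd e refl p) = reverseʷ p ++ʷ bwd e refl []
  reverseʷ (bwd e refl p) = reverseʷ p ++ʷ fwd e refl []

  module _ {Q : Fin m → Set} where

    All-++ʷ : ∀ {u v w} (p : Walk G u v) {q : Walk G v w} →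
              All Q (edges G p) → All Q (edges G q) → All Q (edges G (p ++ʷ q))
    All-++ʷ []          _         qs = qs
    All-++ʷ (fwd e _ p) (qe ∷ ps) qs = qe ∷ All-++ʷ p ps qs
    All-++ʷ (bwd e _ p) (qe ∷ ps) qs = qe ∷ All-++ʷ p ps qs

    All-reverseʷ : ∀ {u v} (p : Walk G u v) → All Q (edges G p) → All Q (edges G (reverseʷ p))
    All-reverseʷ []             _         = []
    All-reverseʷ (fwd e refl p) (qe ∷ ps) = All-++ʷ (reverseʷ p) (All-reverseʷ p ps) (qe ∷ [])
    All-reverseʷ (bwd e refl p) (qe ∷ ps) = All-++ʷ (reverseʷ p) (All-reverseʷ p ps) (qe ∷ [])

  Forward : ∀ {u v} → Walk G u v → Set
  Forward []          = ⊤
  Forward (fwd _ _ p) = Forward p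
  Forward (bwd _ _ _) = ⊥

  #bwd-forward : ∀ {u v} (p : Walk G u v) → Forward p → #bwd G p ≡ 0
  #bwd-forward []          _  = refl
  #bwd-forward (fwd _ _ p) fp = #bwd-forward p fp

  tails-forward : ∀ {u v} (p : Walk G u v) → Forward p → map tail (edges G p) ≡ starts G p
  tails-forward []             _  = refl
  tails-forward (fwd e refl p) fp = cong (tail e ∷_) (tails-forward p fp)

  forward-unique-edges : ∀ {u v} (p : Walk G u v) → Forward p →
                         Unique (starts G p) → Unique (edges G p)
  forward-unique-edges p fp u = map⁻ (subst Unique (sym (tails-forward p fp)) u)

  no-directed-cycle : SemiBalanced G → ∀ {u} (w : Walk G u u) → IsCycle G w → ¬ Forward w
  no-directed-cycle sb (fwd e eq p) cyc fp with trans (sb _ (fwd e eq p) cyc) (#bwd-forward p fp)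
  ... | ()

  Acyclic : List (Fin m) → Set
  Acyclic H = ∀ u (w : Walk G u u) → IsCycle G w → ¬ All (_∈ H) (edges G w)

  acyclic-[] : Acyclic []
  acyclic-[] _ []          (() , _)
  acyclic-[] _ (fwd _ _ _) _        (() ∷ _)
  acyclic-[] _ (bwd _ _ _) _        (() ∷ _)

  -- Along a walk in e ∷ H whose edges are distinct, "being at tail e"
  -- toggles exactly when e is traversed, so no cycle can use e.
  module Pendant {e : Fin m} {H : List (Fin m)} (loopless : tail e ≢ head e)
                 (pendant : ∀ {a} → a ∈ H → ¬ Incident G (tail e) a) where

    at-tail : Fin n → Bool
    at-tail v = does (v ≟F tail e)

    not-at-tail : ∀ {v} → v ≢ tail e → at-tail v ≡ false
    not-at-tail = dec-false (_ ≟F tail e)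

    at-tail-constant : ∀ {u v} (p : Walk G u v) → All (_∈ H) (edges G p) → at-tail u ≡ at-tail v
    at-tail-constant []             _         = refl
    at-tail-constant (fwd g refl p) (g∈ ∷ ps) =
      trans (not-at-tail (pendant g∈ ∘ inj₁))
            (trans (sym (not-at-tail (pendant g∈ ∘ inj₂))) (at-tail-constant p ps))
    at-tail-constant (bwd g refl p) (g∈ ∷ ps) =
      trans (not-at-tail (pendant g∈ ∘ inj₂))
            (trans (sym (not-at-tail (pendant g∈ ∘ inj₁))) (at-tail-constant p ps))

    without-e : ∀ {es} → All (_∈ e ∷ H) es → e ∉ es → All (_∈ H) es
    without-e []                _  = []
    without-e (here refl  ∷ _)  e∉ = contradiction (here refl) e∉
    without-e (there a∈H ∷ ps) e∉ = a∈H ∷ without-e ps (e∉ ∘ there)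

    at-tail-flips : ∀ {u v} (p : Walk G u v) → All (_∈ e ∷ H) (edges G p) →
                    Unique (edges G p) → e ∈ edges G p → at-tail u ≡ not (at-tail v)
    at-tail-flips (fwd g refl p) (here refl ∷ ps) (e∉p ∷ _) _ =
      trans (dec-true (tail e ≟F tail e) refl)
            (cong not (trans (sym (not-at-tail (loopless ∘ sym)))
                             (at-tail-constant p (without-e ps (All¬⇒¬Any e∉p)))))
    at-tail-flips (bwd g refl p) (here refl ∷ ps) (e∉p ∷ _) _ =
      trans (not-at-tail (loopless ∘ sym))
            (cong not (trans (sym (dec-true (tail e ≟F tail e) refl))
                             (at-tail-constant p (without-e ps (All¬⇒¬Any e∉p)))))
    at-tail-flips (fwd g refl p) (there g∈ ∷ _) _ (here refl) =
      contradiction (inj₁ refl) (pendant g∈)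
    at-tail-flips (bwd g refl p) (there g∈ ∷ _) _ (here refl) =
      contradiction (inj₁ refl) (pendant g∈)
    at-tail-flips (fwd g refl p) (there g∈ ∷ ps) (_ ∷ up) (there e∈) =
      trans (not-at-tail (pendant g∈ ∘ inj₁))
            (trans (sym (not-at-tail (pendant g∈ ∘ inj₂))) (at-tail-flips p ps up e∈))
    at-tail-flips (bwd g refl p) (there g∈ ∷ ps) (_ ∷ up) (there e∈) =
      trans (not-at-tail (pendant g∈ ∘ inj₂))
            (trans (sym (not-at-tail (pendant g∈ ∘ inj₁))) (at-tail-flips p ps up e∈))

    acyclic-∷ : Acyclic H → Acyclic (e ∷ H)
    acyclic-∷ acyclic u w cyc@(_ , unique , _) in-e∷H with Any.any? (e ≟F_) (edges G w)
    ... | yes e∈ = not-¬ refl (at-tail-flips w in-e∷H unique e∈)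
    ... | no  e∉ = acyclic u w cyc (without-e in-e∷H e∉)

module Halting {n m} (G : Digraph n m) (R : Ribbon G) where
  open Digraph G
  open Greedy G R

  past-step : ∀ σ → State.past (step σ) ≡ State.cur σ ∷ State.past σ
  past-step (st (x , e) P H) with head e ≟F x
  ... | yes refl with _∈?_ G (tail e , e) P
  ...   | true  = refl
  ...   | false = refl
  past-step (st (x , e) P H) | no _ with _∈?_ G (head e , e) P
  ...   | true  = refl
  ...   | false = refl

  past-run : ∀ k σ → State.past σ ⊆ State.past (run k σ)
  past-run zero    σ     = id
  past-run (suc k) σ p∈ = past-run k (step σ) (subst (_ ∈_) (sym (past-step σ)) (there p∈))

  current∈later-past : ∀ {i j} σ → i < j → State.cur (run i σ) ∈ State.past (run j σ)
  current∈later-past {zero}  {suc j} σ _ =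
    past-run j (step σ) (subst (_ ∈_) (sym (past-step σ)) (here refl))
  current∈later-past {suc i} {suc j} σ (s<s i<j) = current∈later-past (step σ) i<j

  stopped? : ∀ σ → Dec (Stopped σ)
  stopped? σ = Any.any? (≡-dec _≟F_ _≟F_ (State.cur σ)) (State.past σ)

  eventually-stopped : ∀ σ → ∃ λ k → Stopped (run k σ)
  eventually-stopped σ with pigeonhole (n<1+n (n * m)) (λ i → code (toℕ i))
    where code : ℕ → Fin (n * m)
          code k = combine (proj₁ (State.cur (run k σ))) (proj₂ (State.cur (run k σ)))
  ... | i , j , i<j , same =
    toℕ j , subst (_∈ State.past (run (toℕ j) σ)) (×-≡,≡→≡ (combine-injective _ _ _ _ same))
                  (current∈later-past σ i<j)

  halts : ∀ σ → Least (λ k → Stopped (run k σ))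
  halts σ with k , stopped ← eventually-stopped σ =
    least {P = λ k → Stopped (run k σ)} (λ k → stopped? (run k σ)) {k} stopped

module Search {n m} (G : Digraph n m) (semiBalanced : SemiBalanced G) (R : Ribbon G)
              (b₀ : Fin n) where
  open Digraph G
  open Ribbon R
  open Greedy G R
  open Walks G

  ∈?-true : ∀ {p ps} → _∈?_ G p ps ≡ true → p ∈ ps
  ∈?-true eq = Any.map toWitness (any⁻ _ _ (subst T (sym eq) tt))

  ∈?-false : ∀ {p ps} → _∈?_ G p ps ≡ false → p ∉ ps
  ∈?-false eq p∈ = subst T eq (any⁺ _ (Any.map fromWitness p∈))

  data Stack : Fin n → Set where
    base : Stack b₀
    push : (a : Fin m) → Stack (head a) → Stack (tail a)

  stack-walk : ∀ {v} → Stack v → Walk G v b₀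
  stack-walk base       = []
  stack-walk (push a s) = fwd a refl (stack-walk s)

  stack-edges : ∀ {v} → Stack v → List (Fin m)
  stack-edges s = edges G (stack-walk s)

  vertices : ∀ {v} → Stack v → List (Fin n)
  vertices base       = b₀ ∷ []
  vertices (push a s) = tail a ∷ vertices s

  top∈vertices : ∀ {v} (s : Stack v) → v ∈ vertices s
  top∈vertices base       = here refl
  top∈vertices (push a s) = here refl

  head∈vertices : ∀ {v} (s : Stack v) {a} → a ∈ stack-edges s → head a ∈ vertices s
  head∈vertices (push a s) (here refl) = there (top∈vertices s)
  head∈vertices (push a s) (there a∈)  = there (head∈vertices s a∈)

  forward-path : ∀ {v} (s : Stack v) → Unique (vertices s) → ∀ {t} → t ∈ vertices s →
                 Σ (Walk G v t) λ p → Forward p × Unique (t ∷ starts G p) × starts G p ⊆ vertices s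
  forward-path base       _ (here refl) = [] , tt , [] ∷ [] , λ ()
  forward-path (push a s) _ (here refl) = [] , tt , [] ∷ [] , λ ()
  forward-path (push a s) (tail∉s ∷ unique) (there t∈) with forward-path s unique t∈
  ... | p , fp , (t∉p ∷ unique-p) , p⊆s =
    fwd a refl p , fp ,
    ((All.lookup tail∉s t∈ ∘ sym ∷ t∉p) ∷ (All.tabulate (All.lookup tail∉s ∘ p⊆s) ∷ unique-p)) ,
    λ { (here refl) → here refl ; (there x∈) → there (p⊆s x∈) }

  tail∉stack : ∀ {e} (s : Stack (head e)) → Unique (vertices s) → tail e ∉ vertices s
  tail∉stack {e} s unique t∈ with forward-path s unique t∈
  ... | p , fp , unique-p , _ =
    no-directed-cycle semiBalanced (fwd e refl p)
      (tt , forward-unique-edges (fwd e refl p) fp unique-p , unique-p) fp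

  Visited : List (Pair G) → Fin n → Set
  Visited Q v = ∃ λ g → (v , g) ∈ Q

  visited-∷ : ∀ {c Q v} → Visited Q v → Visited (c ∷ Q) v
  visited-∷ (g , p) = g , there p

  -- the pair (head g , g) whose successor is postponed until g is popped
  Suspended : ∀ {x} → Stack x → Fin n → Fin m → Set
  Suspended s v g = g ∈ stack-edges s × head g ≡ v

  PathToRoot : List (Fin m) → Fin n → Set
  PathToRoot H v = ∃ λ (w : Walk G v b₀) → All (_∈ H) (edges G w)

  record Traversal {x : Fin n} (e : Fin m) (P : List (Pair G)) (H : List (Fin m))
                   (s : Stack x) : Set where
    field
      stack-unique     : Unique (vertices s)
      stack⊆tree       : stack-edges s ⊆ H
      current-incident : Incident G x e
      past-incident    : ∀ {v g} → (v , g) ∈ P → Incident G v g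
      past-closed      : ∀ {v g} → (v , g) ∈ P → (v , next v g) ∈ (x , e) ∷ P ⊎ Suspended s v g
      head-first       : ∀ {g} → (head g , g) ∈ P → (tail g , g) ∈ P ⊎ g ∈ H
      stack-resumed    : ∀ {a} → a ∈ stack-edges s → (tail a , next (tail a) a) ∈ (x , e) ∷ P

  record TreeFacts (Q : List (Pair G)) (H : List (Fin m)) : Set where
    field
      tree-visited  : ∀ {a v} → a ∈ H → Incident G v a → Visited Q v
      root-visited  : Visited Q b₀
      tails-unique  : ∀ {a a′} → a ∈ H → a′ ∈ H → tail a ≡ tail a′ → a ≡ a′
      root-not-tail : ∀ {a} → a ∈ H → tail a ≢ b₀
      acyclic       : Acyclic H
      reaches-root  : ∀ {v} → Touches G H v → PathToRoot H v

  open Traversal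
  open TreeFacts

  TreeFacts-∷ : ∀ {c Q H} → TreeFacts Q H → TreeFacts (c ∷ Q) H
  TreeFacts-∷ F = record
    { tree-visited  = λ a∈ inc → visited-∷ (tree-visited F a∈ inc)
    ; root-visited  = visited-∷ (root-visited F)
    ; tails-unique  = tails-unique F
    ; root-not-tail = root-not-tail F
    ; acyclic       = acyclic F
    ; reaches-root  = reaches-root F
    }

  saturated : ∀ {x e P H} {s : Stack x} → Traversal e P H s → ∀ {t g g′} → (t , g) ∈ P →
              t ≢ x → t ∉ vertices s → Incident G t g′ → (t , g′) ∈ P
  saturated {x} {P = P} {s = s} T {t} {g} p t≢x t∉s inc′
    with next-cyclic t g _ (past-incident T p) inc′
  ... | k , refl = iterates k
    where
      iterates : ∀ k → (t , iter G k (next t) g) ∈ P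
      iterates zero = p
      iterates (suc k) with past-closed T (iterates k)
      ... | inj₁ (here eq)    = contradiction (cong proj₁ eq) t≢x
      ... | inj₁ (there q)    = q
      ... | inj₂ (g∈ , head≡t) =
        contradiction (subst (_∈ vertices s) head≡t (head∈vertices s g∈)) t∉s

  stay : ∀ {x e P H} {s : Stack x} → Traversal e P H s →
         (head e ≡ x → (tail e , e) ∈ P ⊎ e ∈ H) → Traversal (next x e) ((x , e) ∷ P) H s
  stay {x} {e} {P} {H} T head-first-current = record
    { stack-unique     = stack-unique T
    ; stack⊆tree       = stack⊆tree T
    ; current-incident = next-inc x e (current-incident T)
    ; past-incident    = λ { (here refl) → current-incident T ; (there p) → past-incident T p }
    ; past-closed      = λ { (here refl) → inj₁ (here refl)
                           ; (there p)   → Sum.map₁ there (past-closed T p) }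
    ; head-first       = λ { (here eq) → current (×-≡,≡←≡ eq)
                           ; (there p) → Sum.map₁ there (head-first T p) }
    ; stack-resumed    = λ a∈ → there (stack-resumed T a∈)
    }
    where
      current : ∀ {g} → head g ≡ x × g ≡ e → (tail g , g) ∈ (x , e) ∷ P ⊎ g ∈ H
      current (head≡x , refl) = Sum.map₁ there (head-first-current head≡x)

  pop-traversal : ∀ {e P H} {s : Stack (head e)} → Traversal e P H (push e s) → e ∈ H →
                  Traversal (next (head e) e) ((tail e , e) ∷ P) H s
  pop-traversal {e} T e∈H = record
    { stack-unique     = unique-tail (stack-unique T)
    ; stack⊆tree       = λ a∈ → stack⊆tree T (there a∈)
    ; current-incident = next-inc (head e) e (inj₂ refl)
    ; past-incident    = λ { (here refl) → current-incident T ; (there p) → past-incident T p }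
    ; past-closed      = λ { (here refl) → inj₁ (there (stack-resumed T (here refl)))
                           ; (there p)   → resume (past-closed T p) }
    ; head-first       = λ { (here eq) → inj₂ (subst (_∈ _) (sym (proj₂ (×-≡,≡←≡ eq))) e∈H)
                           ; (there p) → Sum.map₁ there (head-first T p) }
    ; stack-resumed    = λ a∈ → there (stack-resumed T (there a∈))
    }
    where
      unique-tail : ∀ {x xs} → Unique (x ∷ xs) → Unique xs
      unique-tail (_ ∷ unique) = unique
      resume : ∀ {v g P′ s} → (v , next v g) ∈ P′ ⊎ Suspended (push e s) v g →
               (v , next v g) ∈ (head e , next (head e) e) ∷ P′ ⊎ Suspended s v g
      resume (inj₁ p)                  = inj₁ (there p)
      resume (inj₂ (here refl , refl)) = inj₁ (here refl)
      resume (inj₂ (there g∈ , h))     = inj₂ (g∈ , h)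

  -- the tree is oriented towards b₀, so the edge being backtracked is the top of the stack
  backtrack : ∀ {x e P H} (s : Stack x) → Traversal e P H s → TreeFacts ((x , e) ∷ P) H →
              tail e ≡ x → e ∈ H → Σ (Stack (head e)) (Traversal (next (head e) e) ((x , e) ∷ P) H)
  backtrack base       T F tail≡b₀ e∈H = contradiction tail≡b₀ (root-not-tail F e∈H)
  backtrack (push a s) T F tail≡    e∈H with tails-unique F e∈H (stack⊆tree T (here refl)) tail≡
  ... | refl = s , pop-traversal T e∈H

  module Include {e P H} {s : Stack (head e)} (T : Traversal e P H s)
                 (F : TreeFacts ((head e , e) ∷ P) H) (fresh : (tail e , e) ∉ P) where

    tail∉vertices : tail e ∉ vertices s
    tail∉vertices = tail∉stack s (stack-unique T)

    loopless : tail e ≢ head e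
    loopless eq = tail∉vertices (subst (_∈ vertices s) (sym eq) (top∈vertices s))

    tail-unvisited : ¬ Visited ((head e , e) ∷ P) (tail e)
    tail-unvisited (_ , here eq) = loopless (cong proj₁ eq)
    tail-unvisited (_ , there p) = fresh (saturated T p loopless tail∉vertices (inj₁ refl))

    pendant : ∀ {a} → a ∈ H → ¬ Incident G (tail e) a
    pendant a∈ inc = tail-unvisited (tree-visited F a∈ inc)

    traversal : Traversal (next (tail e) e) ((head e , e) ∷ P) (e ∷ H) (push e s)
    traversal = record
      { stack-unique     = ¬Any⇒All¬ _ tail∉vertices ∷ stack-unique T
      ; stack⊆tree       = λ { (here refl) → here refl ; (there a∈) → there (stack⊆tree T a∈) }
      ; current-incident = next-inc (tail e) e (inj₁ refl)
      ; past-incident    = λ { (here refl) → inj₂ refl ; (there p) → past-incident T p }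
      ; past-closed      = λ { (here refl) → inj₂ (here refl , refl)
                             ; (there p)   → Sum.map there (Product.map₁ there) (past-closed T p) }
      ; head-first       = λ { (here eq) → inj₂ (here (proj₂ (×-≡,≡←≡ eq)))
                             ; (there p) → Sum.map there there (head-first T p) }
      ; stack-resumed    = λ { (here refl) → here refl ; (there a∈) → there (stack-resumed T a∈) }
      }

    stack-in-tree : All (_∈ e ∷ H) (stack-edges s)
    stack-in-tree = All.tabulate (there ∘ stack⊆tree T)

    treeFacts : TreeFacts ((tail e , next (tail e) e) ∷ (head e , e) ∷ P) (e ∷ H)
    treeFacts = record
      { tree-visited  = λ { (here refl) (inj₁ refl) → _ , here refl
                          ; (here refl) (inj₂ refl) → _ , there (here refl)
                          ; (there a∈)  inc         → visited-∷ (tree-visited F a∈ inc) }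
      ; root-visited  = visited-∷ (root-visited F)
      ; tails-unique  = λ { (here refl) (here refl)  _  → refl
                          ; (here refl) (there a′∈) eq → contradiction (inj₁ (sym eq)) (pendant a′∈)
                          ; (there a∈)  (here refl) eq → contradiction (inj₁ eq) (pendant a∈)
                          ; (there a∈)  (there a′∈) eq → tails-unique F a∈ a′∈ eq }
      ; root-not-tail = λ { (here refl) tail≡b₀ →
                              tail-unvisited (subst (Visited _) (sym tail≡b₀) (root-visited F))
                          ; (there a∈) → root-not-tail F a∈ }
      ; acyclic       = Pendant.acyclic-∷ {e} {H} loopless pendant (acyclic F)
      ; reaches-root  = λ { (_ , here refl , inj₁ tail≡v) →
                              fwd e tail≡v (stack-walk s) , here refl ∷ stack-in-tree
                          ; (_ , here refl , inj₂ refl)   → stack-walk s , stack-in-tree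
                          ; (_ , there a∈ , inc)          →
                              Product.map₂ (All.map there) (reaches-root F (_ , a∈ , inc)) }
      }

  Invariant : State G → Set
  Invariant (st (x , e) P H) = Σ (Stack x) λ s → Traversal e P H s × TreeFacts ((x , e) ∷ P) H

  initial-invariant : ∀ {e₀} → Incident G b₀ e₀ → Invariant (init b₀ e₀)
  initial-invariant b₀∈e₀ = base , traversal , treeFacts
    where
      traversal : Traversal _ [] [] base
      traversal = record
        { stack-unique = [] ∷ [] ; stack⊆tree = λ () ; current-incident = b₀∈e₀
        ; past-incident = λ () ; past-closed = λ () ; head-first = λ () ; stack-resumed = λ () }
      treeFacts : TreeFacts (_ ∷ []) []
      treeFacts = record
        { tree-visited = λ () ; root-visited = _ , here refl ; tails-unique = λ ()
        ; root-not-tail = λ () ; acyclic = acyclic-[] ; reaches-root = λ { (_ , () , _) } }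

  step-preserves : ∀ σ → Invariant σ → ¬ Stopped σ → Invariant (step σ)
  step-preserves (st (x , e) P H) (s , T , F) running with head e ≟F x
  ... | yes refl with _∈?_ G (tail e , e) P in seen
  ...   | true  = s , stay T (λ _ → inj₁ (∈?-true seen)) , TreeFacts-∷ F
  ...   | false = push e s , traversal , treeFacts
    where open Include T F (∈?-false seen)
  step-preserves (st (x , e) P H) (s , T , F) running | no head≢x with _∈?_ G (head e , e) P in seen
  ...   | false = s , stay T (λ head≡x → contradiction head≡x head≢x) , TreeFacts-∷ F
  ...   | true with current-incident T | head-first T (∈?-true seen)
  ...     | inj₂ head≡x | _             = contradiction head≡x head≢x
  ...     | inj₁ refl   | inj₁ tail-seen = contradiction tail-seen running
  ...     | inj₁ refl   | inj₂ e∈H       =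
    let s′ , T′ = backtrack s T F refl e∈H in s′ , T′ , TreeFacts-∷ F

  invariant-run : ∀ k σ → Invariant σ → (∀ j → j < k → ¬ Stopped (run j σ)) → Invariant (run k σ)
  invariant-run zero    σ I _       = I
  invariant-run (suc k) σ I running =
    invariant-run k (step σ) (step-preserves σ I (running 0 z<s))
                  (λ j j<k → running (suc j) (s<s j<k))

  tree : ∀ σ → Invariant σ → IsTree G (State.H σ)
  tree (st _ _ H) (_ , _ , F) =
    acyclic F , λ _ _ x∈ y∈ → join (reaches-root F x∈) (reaches-root F y∈)
    where
      join : ∀ {x y} → PathToRoot H x → PathToRoot H y →
             ∃ λ (w : Walk G x y) → All (_∈ H) (edges G w)
      join (p , p∈H) (q , q∈H) = p ++ʷ reverseʷ q , All-++ʷ p p∈H (All-reverseʷ q q∈H)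

lemma4p6 : ∀ {n m} (G : Digraph n m) → SemiBalanced G → NoMultipleEdges G →
    (R : Ribbon G) (b₀ : Fin n) (b₀b₁ : Fin m) → Incident G b₀ b₀b₁ →
    ∃ λ (H : List (Fin m)) → Greedy.Outputs G R b₀ b₀b₁ H × IsTree G H
lemma4p6 G semiBalanced _ R b₀ b₀b₁ b₀∈b₀b₁
  with k , stopped , running ← Halting.halts G R (Greedy.init G R b₀ b₀b₁) =
  State.H σₖ , (k , stopped , running , refl) ,
  tree σₖ (invariant-run k _ (initial-invariant b₀∈b₀b₁) running)
  where
    open Search G semiBalanced R b₀
    σₖ : State G
    σₖ = Greedy.run G R k (Greedy.init G R b₀ b₀b₁)
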